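{- Let $a\neq b$ be distinct positive integers and let $w$ be a finite word over the positive integers. Then $$\alpha_b(P(wa))\preceq\alpha_b(P(w))\preceq\alpha_b(P(aw)),$$ where $wa$ and $aw$ denote concatenation of $w$ with the one-letter word $a$.
   Context: For a word $v$ over the positive integers, $P(v)$ denotes its insertion tableau under the Robinson–Schensted–Knuth (RSK) correspondence (row insertion, English convention: row $1$ is the top row). For a sequence $R$ and an integer $a$, $m_a(R)$ is the multiplicity of $a$ in $R$. For a semistandard Young tableau $P$ with rows $R_1,R_2,\ldots$ (rows beyond the last being empty), $\alpha_a(P)=(m_a(R_1),m_a(R_2),\ldots)$, a weak composition. Weak compositions are compared in dominance order: $\alpha\preceq\beta$ iff $\alpha_1+\cdots+\alpha_i\le\beta_1+\cdots+\beta_i$ for all $i\ge1$. -}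

module Defs where

open import Data.Nat using (ℕ; zero; suc; _+_; _≤_; _<ᵇ_)
open import Data.Bool using (Bool; true; false; if_then_else_)
open import Data.List using (List; []; _∷_; foldl; length; filter; map; take; [_]; _++_)
open import Data.Nat.ListAction using (sum)
open import Data.Maybe using (Maybe; just; nothing)
open import Data.Product using (_×_; _,_)
open import Relation.Nullary.Decidable using (does)
open import Data.Nat using (_≟_)

-- Words over the positive integers are lists of naturals (positivity is a
-- separate hypothesis in the statement).
Word : Set
Word = List ℕ

-- A tableau is its list of rows, top row (row 1) first (English convention).
Row : Set
Row = List ℕ

Tableau : Set
Tableau = List Row

rowInsert : ℕ → Row → Row × Maybe ℕ
rowInsert x [] = (x ∷ []) , nothing
rowInsert x (y ∷ ys) with x <ᵇ y
... | true  = (x ∷ ys) , just y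
... | false with rowInsert x ys
...   | (ys' , r) = (y ∷ ys') , r

insert : ℕ → Tableau → Tableau
insert x [] = (x ∷ []) ∷ []
insert x (R ∷ Rs) with rowInsert x R
... | (R' , nothing) = R' ∷ Rs
... | (R' , just y)  = R' ∷ insert y Rs

P : Word → Tableau
P v = foldl (λ T x → insert x T) [] v

mult : ℕ → List ℕ → ℕ
mult a R = length (filter (λ y → y ≟ a) R)

-- α_a(P) = (m_a(R_1), m_a(R_2), ...); entries beyond the last row are 0,
-- represented implicitly by the end of the list.
α : ℕ → Tableau → List ℕ
α a T = map (mult a) T

partialSum : ℕ → List ℕ → ℕ
partialSum i α = sum (take i α)

_⪯_ : List ℕ → List ℕ → Set
α ⪯ β = ∀ (i : ℕ) → 1 ≤ i → partialSum i α ≤ partialSum i β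

module Submission where

open import Defs
open import Data.Nat using (ℕ; zero; suc; _+_; _≤_; _<_; _<ᵇ_; z≤n)
open import Data.Nat.Properties
open import Data.Bool using (true; false)
import Data.Bool as Bool
open import Data.List using (List; _∷_; []; _++_; foldl; [_]; drop; filter; length; fromMaybe)
open import Data.List.Properties using (length-++; filter-++; filter-reject; foldl-++)
open import Data.List.Relation.Unary.All as All using (All; []; _∷_)
open import Data.List.Relation.Unary.AllPairs using (AllPairs; []; _∷_)
open import Data.List.Relation.Binary.Permutation.Propositional
  using (_↭_; ↭-refl; ↭-prep; ↭-swap; ↭-sym; ↭-trans)
open import Data.List.Relation.Binary.Permutation.Propositional.Properties
  using (↭-length; filter-↭; shift; ∷↭∷ʳ)
open import Data.List.Relation.Binary.Sublist.Propositional using (_⊆_; []; _∷_; _∷ʳ_; ⊆-refl)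
import Data.List.Relation.Binary.Sublist.Propositional.Properties as Sublist
open import Data.Maybe using (Maybe; just; nothing)
open import Data.Maybe.Properties using (just-injective)
open import Data.Product using (_×_; _,_; proj₁; proj₂; map; map₁; uncurry)
open import Data.Sum using (_⊎_; inj₁; inj₂; map₂)
open import Data.Empty using (⊥; ⊥-elim)
open import Data.Unit using (⊤; tt)
open import Function using (_∘_; case_of_)
open import Relation.Binary.PropositionalEquality
  using (_≡_; _≢_; refl; sym; trans; cong; subst; module ≡-Reasoning)
open import Relation.Nullary using (yes; no)

-- Appending a to w row-inserts a into P(w). The bumped letters travel down, each row
-- receiving one letter and passing one on, so the top i rows gain at most the letter a
-- itself: for a ≠ b their number of b's cannot grow.
--
-- Prepending a to w column-inserts a into P(w), because column insertion commutes with row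
-- insertion. Column insertion only adds a and moves entries into higher rows, so the number
-- of b's in the top i rows cannot drop.

<ᵇ≡true⇒< : ∀ {x y} → (x <ᵇ y) ≡ true → x < y
<ᵇ≡true⇒< {x} {y} e = <ᵇ⇒< x y (subst Bool.T (sym e) tt)

<ᵇ≡false⇒≥ : ∀ {x y} → (x <ᵇ y) ≡ false → y ≤ x
<ᵇ≡false⇒≥ e = ≮⇒≥ (λ p → subst Bool.T e (<⇒<ᵇ p))

<⇒<ᵇ≡true : ∀ {x y} → x < y → (x <ᵇ y) ≡ true
<⇒<ᵇ≡true {x} {y} p with x <ᵇ y | <⇒<ᵇ p
... | true | _ = refl

≥⇒<ᵇ≡false : ∀ {x y} → y ≤ x → (x <ᵇ y) ≡ false
≥⇒<ᵇ≡false {x} {y} p with x <ᵇ y in e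
... | true  = ⊥-elim (<⇒≱ (<ᵇ≡true⇒< e) p)
... | false = refl

Sorted : Row → Set
Sorted = AllPairs _≤_

ColumnStrict : Row → Row → Set
ColumnStrict R       []      = ⊤
ColumnStrict []      (s ∷ S) = ⊥
ColumnStrict (r ∷ R) (s ∷ S) = r < s × ColumnStrict R S

firstRow : Tableau → Row
firstRow []      = []
firstRow (S ∷ _) = S

Semistandard : Tableau → Set
Semistandard []      = ⊤
Semistandard (R ∷ T) = Sorted R × R ≢ [] × ColumnStrict R (firstRow T) × Semistandard T

-- Row insertion

rowInsertMaybe : Maybe ℕ → Row → Row × Maybe ℕ
rowInsertMaybe nothing  S = S , nothing
rowInsertMaybe (just m) S = rowInsert m S

insertMaybe : Maybe ℕ → Tableau → Tableau
insertMaybe nothing  T = T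
insertMaybe (just m) T = insert m T

insert-∷ : ∀ x R T →
  insert x (R ∷ T) ≡ proj₁ (rowInsert x R) ∷ insertMaybe (proj₂ (rowInsert x R)) T
insert-∷ x R T with rowInsert x R
... | R′ , nothing = refl
... | R′ , just y  = refl

insertMaybe-∷ : ∀ m S T →
  insertMaybe m (S ∷ T) ≡ proj₁ (rowInsertMaybe m S) ∷ insertMaybe (proj₂ (rowInsertMaybe m S)) T
insertMaybe-∷ nothing  S T = refl
insertMaybe-∷ (just m) S T = insert-∷ m S T

rowInsert-All : ∀ {P : ℕ → Set} y R → All P R → P y → All P (proj₁ (rowInsert y R))
rowInsert-All y []      []        py = py ∷ []
rowInsert-All y (r ∷ R) (pr ∷ pR) py with y <ᵇ r
... | true  = py ∷ pR
... | false = pr ∷ rowInsert-All y R pR py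

rowInsert-bumped-All : ∀ {P : ℕ → Set} y R {m} → All P R → proj₂ (rowInsert y R) ≡ just m → P m
rowInsert-bumped-All y (r ∷ R) (pr ∷ pR) eq with y <ᵇ r
rowInsert-bumped-All y (r ∷ R) (pr ∷ pR) refl | true = pr
... | false = rowInsert-bumped-All y R pR eq

rowInsert-<-bumped : ∀ y R {m} → proj₂ (rowInsert y R) ≡ just m → y < m
rowInsert-<-bumped y (r ∷ R) eq with y <ᵇ r in e
rowInsert-<-bumped y (r ∷ R) refl | true = <ᵇ≡true⇒< e
... | false = rowInsert-<-bumped y R eq

rowInsert-nothing⇒≤ : ∀ y R → proj₂ (rowInsert y R) ≡ nothing → All (_≤ y) R
rowInsert-nothing⇒≤ y []      eq = []
rowInsert-nothing⇒≤ y (r ∷ R) eq with y <ᵇ r in e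
... | false = <ᵇ≡false⇒≥ e ∷ rowInsert-nothing⇒≤ y R eq

rowInsert-just⇒≤⊎≥ : ∀ y R {m} → Sorted R → proj₂ (rowInsert y R) ≡ just m →
  All (λ z → z ≤ y ⊎ m ≤ z) R
rowInsert-just⇒≤⊎≥ y (r ∷ R) (r≤R ∷ sR) eq with y <ᵇ r in e
rowInsert-just⇒≤⊎≥ y (r ∷ R) (r≤R ∷ sR) refl | true = inj₂ ≤-refl ∷ All.map inj₂ r≤R
... | false = inj₁ (<ᵇ≡false⇒≥ e) ∷ rowInsert-just⇒≤⊎≥ y R sR eq

rowInsert-skip : ∀ y x X → x ≤ y →
  rowInsert y (x ∷ X) ≡ ((x ∷ proj₁ (rowInsert y X)) , proj₂ (rowInsert y X))
rowInsert-skip y x X x≤y rewrite ≥⇒<ᵇ≡false {y} {x} x≤y = refl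

rowInsertMaybe-skip : ∀ m s X → (∀ v → m ≡ just v → s ≤ v) →
  rowInsertMaybe m (s ∷ X) ≡ ((s ∷ proj₁ (rowInsertMaybe m X)) , proj₂ (rowInsertMaybe m X))
rowInsertMaybe-skip nothing  s X s≤m = refl
rowInsertMaybe-skip (just v) s X s≤m = rowInsert-skip v s X (s≤m v refl)

rowInsert-sorted : ∀ y R → Sorted R → Sorted (proj₁ (rowInsert y R))
rowInsert-sorted y []      _          = [] ∷ []
rowInsert-sorted y (r ∷ R) (r≤R ∷ sR) with y <ᵇ r in e
... | true  = All.map (≤-trans (<⇒≤ (<ᵇ≡true⇒< e))) r≤R ∷ sR
... | false = rowInsert-All y R r≤R (<ᵇ≡false⇒≥ e) ∷ rowInsert-sorted y R sR

rowInsert-nonempty : ∀ y R → proj₁ (rowInsert y R) ≢ []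
rowInsert-nonempty y []      = λ ()
rowInsert-nonempty y (r ∷ R) with y <ᵇ r
... | true  = λ ()
... | false = λ ()

ColumnStrict-rowInsert₁ : ∀ y R S → ColumnStrict R S → ColumnStrict (proj₁ (rowInsert y R)) S
ColumnStrict-rowInsert₁ y []      []      _ = tt
ColumnStrict-rowInsert₁ y (r ∷ R) []      _ with y <ᵇ r
... | true  = tt
... | false = tt
ColumnStrict-rowInsert₁ y (r ∷ R) (s ∷ S) (r<s , c) with y <ᵇ r in e
... | true  = <-trans (<ᵇ≡true⇒< e) r<s , c
... | false = r<s , ColumnStrict-rowInsert₁ y R S c

ColumnStrict-rowInsert : ∀ y R S {m} → ColumnStrict R S → proj₂ (rowInsert y R) ≡ just m →
  ColumnStrict (proj₁ (rowInsert y R)) (proj₁ (rowInsert m S))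
ColumnStrict-rowInsert y (r ∷ R) [] _ eq with y <ᵇ r in e
ColumnStrict-rowInsert y (r ∷ R) [] _ refl | true = <ᵇ≡true⇒< e , tt
... | false = ≤-<-trans (<ᵇ≡false⇒≥ e) (rowInsert-<-bumped y R eq) , tt
ColumnStrict-rowInsert y (r ∷ R) (s ∷ S) (r<s , c) eq with y <ᵇ r in e
ColumnStrict-rowInsert y (r ∷ R) (s ∷ S) (r<s , c) refl | true
  rewrite <⇒<ᵇ≡true r<s = <ᵇ≡true⇒< e , c
ColumnStrict-rowInsert y (r ∷ R) (s ∷ S) {m} (r<s , c) eq | false with m <ᵇ s
... | true  = ≤-<-trans (<ᵇ≡false⇒≥ e) (rowInsert-<-bumped y R eq) , ColumnStrict-rowInsert₁ y R S c
... | false = r<s , ColumnStrict-rowInsert y R S c eq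

ColumnStrict-insert : ∀ y R T → ColumnStrict R (firstRow T) →
  ColumnStrict (proj₁ (rowInsert y R)) (firstRow (insertMaybe (proj₂ (rowInsert y R)) T))
ColumnStrict-insert y R T c with proj₂ (rowInsert y R) in e
ColumnStrict-insert y R []      c | nothing = tt
ColumnStrict-insert y R (S ∷ T) c | nothing = ColumnStrict-rowInsert₁ y R S c
ColumnStrict-insert y R []      c | just m  = ColumnStrict-rowInsert y R [] c e
ColumnStrict-insert y R (S ∷ T) c | just m rewrite insert-∷ m S T = ColumnStrict-rowInsert y R S c e

insert-semistandard : ∀ y T → Semistandard T → Semistandard (insert y T)
insert-semistandard y []      _ = ([] ∷ []) , (λ ()) , tt , tt
insert-semistandard y (R ∷ T) (sR , _ , c , sT) rewrite insert-∷ y R T =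
  rowInsert-sorted y R sR , rowInsert-nonempty y R , ColumnStrict-insert y R T c ,
  insertMaybe-semistandard (proj₂ (rowInsert y R))
  where
  insertMaybe-semistandard : ∀ m → Semistandard (insertMaybe m T)
  insertMaybe-semistandard nothing  = sT
  insertMaybe-semistandard (just m) = insert-semistandard m T sT

-- At the first column j where S has an entry S_j that is not larger than R_j (or R has ended),
-- S_j moves up into R at column j; the rest of R shifts right and the rest of S shifts left.
lift : Row → Row → Row × Row
lift R       []      = R , []
lift []      (s ∷ S) = [ s ] , S
lift (r ∷ R) (s ∷ S) with r <ᵇ s
... | true  = (r ∷ proj₁ (lift R S)) , (s ∷ proj₂ (lift R S))
... | false = (s ∷ r ∷ R) , S

lift₁-All : ∀ {P : ℕ → Set} R S → All P R → All P S → All P (proj₁ (lift R S))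
lift₁-All R       []      pR        pS        = pR
lift₁-All []      (s ∷ S) pR        (ps ∷ pS) = ps ∷ []
lift₁-All (r ∷ R) (s ∷ S) (pr ∷ pR) (ps ∷ pS) with r <ᵇ s
... | true  = pr ∷ lift₁-All R S pR pS
... | false = ps ∷ pr ∷ pR

lift₁-sorted : ∀ R S → Sorted R → Sorted S → Sorted (proj₁ (lift R S))
lift₁-sorted R       []      sR             sS             = sR
lift₁-sorted []      (s ∷ S) sR             sS             = [] ∷ []
lift₁-sorted (r ∷ R) (s ∷ S) sR@(r≤R ∷ sR′) (s≤S ∷ sS′) with r <ᵇ s in e
... | true  = lift₁-All R S r≤R (All.map (≤-trans (<⇒≤ (<ᵇ≡true⇒< e))) s≤S)
            ∷ lift₁-sorted R S sR′ sS′
... | false = (<ᵇ≡false⇒≥ e ∷ All.map (≤-trans (<ᵇ≡false⇒≥ e)) r≤R) ∷ sR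

lift-≤-head : ∀ r R X → All (r ≤_) R → lift R (r ∷ X) ≡ ((r ∷ R) , X)
lift-≤-head r []       X _       = refl
lift-≤-head r (r′ ∷ R) X (p ∷ _) rewrite ≥⇒<ᵇ≡false {r′} {r} p = refl

ColumnStrict-drop₁ : ∀ r R S → ColumnStrict (r ∷ R) S → ColumnStrict R (drop 1 S)
ColumnStrict-drop₁ r R []      _       = tt
ColumnStrict-drop₁ r R (s ∷ S) (_ , c) = c

ColumnStrict-tail : ∀ R s S → Sorted R → ColumnStrict R (s ∷ S) → ColumnStrict R S
ColumnStrict-tail (r ∷ R)      s []       _                 _                 = tt
ColumnStrict-tail (r ∷ r′ ∷ R) s (s′ ∷ S) ((r≤r′ ∷ _) ∷ sR) (_ , r′<s′ , c) =
  ≤-<-trans r≤r′ r′<s′ , ColumnStrict-tail (r′ ∷ R) s′ S sR (r′<s′ , c)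

ColumnStrict-lift₁ : ∀ r R b B S → Sorted (r ∷ R) → r < b → ColumnStrict R B →
  All (b ≤_) B → Sorted B → All (b <_) S → Sorted S → ColumnStrict (r ∷ R) (proj₁ (lift B S))
ColumnStrict-lift₁ r R b B [] sR r<b c _ _ _ _ = ColumnStrict-tail (r ∷ R) b B sR (r<b , c)
ColumnStrict-lift₁ r R b [] (s ∷ S) _ r<b _ _ _ (b<s ∷ _) _ = <-trans r<b b<s , tt
ColumnStrict-lift₁ r R b (b′ ∷ B) (s ∷ S) sR r<b c (b≤b′ ∷ _) sB (b<s ∷ _) sS with b′ <ᵇ s in e
... | false = <-trans r<b b<s , c
ColumnStrict-lift₁ r (r′ ∷ R) b (b′ ∷ B) (s ∷ S)
  (_ ∷ sR) r<b (r′<b′ , c) (b≤b′ ∷ _) (b′≤B ∷ sB) _ (s≤S ∷ sS) | true =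
  <-≤-trans r<b b≤b′ ,
  ColumnStrict-lift₁ r′ R b′ B S sR r′<b′ c b′≤B sB (All.map (<-≤-trans (<ᵇ≡true⇒< e)) s≤S) sS

ColumnStrict-drop₁-lift₁ : ∀ R b B S → Sorted R → Sorted (b ∷ B) → Sorted S →
  ColumnStrict R (b ∷ B) → ColumnStrict R (drop 1 (proj₁ (lift (b ∷ B) S)))
ColumnStrict-drop₁-lift₁ R b B [] sR _ _ c = ColumnStrict-tail R b B sR c
ColumnStrict-drop₁-lift₁ R b B (s ∷ S) sR sB sS c with b <ᵇ s in e
ColumnStrict-drop₁-lift₁ R       b B (s ∷ S) sR sB sS c | false = c
ColumnStrict-drop₁-lift₁ (r ∷ R) b B (s ∷ S) sR (b≤B ∷ sB) (s≤S ∷ sS) (r<b , c) | true =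
  ColumnStrict-lift₁ r R b B S sR r<b c b≤B sB (All.map (<-≤-trans (<ᵇ≡true⇒< e)) s≤S) sS

insertPair : ℕ → Row × Row → (Row × Row) × Maybe ℕ
insertPair y (R , S) =
  (proj₁ (rowInsert y R) , proj₁ (rowInsertMaybe (proj₂ (rowInsert y R)) S)) ,
  proj₂ (rowInsertMaybe (proj₂ (rowInsert y R)) S)

rowInsert-lift₁ : ∀ y R S {m} → proj₂ (rowInsert y R) ≡ just m → All (m <_) S →
  rowInsert y (proj₁ (lift R S)) ≡ (proj₁ (lift (proj₁ (rowInsert y R)) S) , just m)
  × proj₂ (lift R S) ≡ proj₂ (lift (proj₁ (rowInsert y R)) S)
rowInsert-lift₁ y R       []      eq m<S = cong (proj₁ (rowInsert y R) ,_) eq , refl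
rowInsert-lift₁ y (r ∷ R) (s ∷ S) eq (m<s ∷ m<S) with r <ᵇ s in e₁ | y <ᵇ r in e₂
rowInsert-lift₁ y (r ∷ R) (s ∷ S) refl _ | true | true
  rewrite e₂ | <⇒<ᵇ≡true {y} {s} (<-trans (<ᵇ≡true⇒< e₂) (<ᵇ≡true⇒< e₁)) = refl , refl
... | true | false rewrite e₁ | e₂ =
  let ih = rowInsert-lift₁ y R S eq m<S in
  cong (λ p → (r ∷ proj₁ p) , proj₂ p) (proj₁ ih) , cong (s ∷_) (proj₂ ih)
rowInsert-lift₁ y (r ∷ R) (s ∷ S) refl (m<s ∷ _) | false | true =
  ⊥-elim (<⇒≱ m<s (<ᵇ≡false⇒≥ e₁))
... | false | false
  rewrite ≥⇒<ᵇ≡false {y} {s} (≤-trans (<ᵇ≡false⇒≥ e₁) (<ᵇ≡false⇒≥ e₂)) | e₂ | e₁ =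
  cong ((s ∷ r ∷ proj₁ (rowInsert y R)) ,_) eq , refl

rowInsert-lift₁-bumped-≥ : ∀ y R S s → Sorted R → All (s ≤_) S →
  (∀ v → proj₂ (rowInsert y R) ≡ just v → s ≤ v) →
  ∀ v → proj₂ (rowInsert y (proj₁ (lift R S))) ≡ just v → s ≤ v
rowInsert-lift₁-bumped-≥ y R S s sR s≤S s≤bump v eq
  with rowInsert-bumped-All y (proj₁ (lift R S)) (lift₁-All R S small-or-large (All.map inj₂ s≤S)) eq
  where
  small-or-large : All (λ z → z ≤ y ⊎ s ≤ z) R
  small-or-large with proj₂ (rowInsert y R) in e
  ... | nothing = All.map inj₁ (rowInsert-nothing⇒≤ y R e)
  ... | just u  = All.map (map₂ (≤-trans (s≤bump u refl))) (rowInsert-just⇒≤⊎≥ y R sR e)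
... | inj₁ v≤y = ⊥-elim (<⇒≱ (rowInsert-<-bumped y (proj₁ (lift R S)) eq) v≤y)
... | inj₂ s≤v = s≤v

insertPair-lift-≥ : ∀ y r R s S → All (r ≤_) R → s ≤ r → ColumnStrict (r ∷ R) S →
  insertPair y (lift (r ∷ R) (s ∷ S)) ≡ map₁ (uncurry lift) (insertPair y (r ∷ R , s ∷ S))
insertPair-lift-≥ y r R s S r≤R s≤r c with y <? s
insertPair-lift-≥ y r R s [] r≤R s≤r _ | yes y<s
  rewrite <⇒<ᵇ≡true {y} {r} (<-≤-trans y<s s≤r) | ≥⇒<ᵇ≡false s≤r | <⇒<ᵇ≡true y<s
        | lift-≤-head r R [] r≤R = refl
insertPair-lift-≥ y r R s (s₁ ∷ S) r≤R s≤r (r<s₁ , _) | yes y<s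
  rewrite <⇒<ᵇ≡true {y} {r} (<-≤-trans y<s s≤r) | ≥⇒<ᵇ≡false s≤r
        | <⇒<ᵇ≡true y<s | <⇒<ᵇ≡true {s} {s₁} (≤-<-trans s≤r r<s₁) | <⇒<ᵇ≡true r<s₁
        | lift-≤-head r R S r≤R = refl
... | no y≮s with y <? r
insertPair-lift-≥ y r R s [] r≤R s≤r _ | no y≮s | yes y<r
  rewrite ≥⇒<ᵇ≡false s≤r | ≥⇒<ᵇ≡false (≮⇒≥ y≮s) | <⇒<ᵇ≡true y<r
        | ≥⇒<ᵇ≡false s≤r | ≥⇒<ᵇ≡false (≮⇒≥ y≮s) = refl
insertPair-lift-≥ y r R s (s₁ ∷ S) r≤R s≤r (r<s₁ , _) | no y≮s | yes y<r
  rewrite ≥⇒<ᵇ≡false s≤r | ≥⇒<ᵇ≡false (≮⇒≥ y≮s) | <⇒<ᵇ≡true y<r | <⇒<ᵇ≡true r<s₁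
        | ≥⇒<ᵇ≡false s≤r | <⇒<ᵇ≡true r<s₁ | ≥⇒<ᵇ≡false (≮⇒≥ y≮s) = refl
... | no y≮r
  rewrite ≥⇒<ᵇ≡false s≤r | ≥⇒<ᵇ≡false (≮⇒≥ y≮s) | ≥⇒<ᵇ≡false (≮⇒≥ y≮r)
        | rowInsertMaybe-skip (proj₂ (rowInsert y R)) s S
            (λ v ev → ≤-trans (≮⇒≥ y≮s) (<⇒≤ (rowInsert-<-bumped y R ev)))
        | ≥⇒<ᵇ≡false s≤r = refl

insertPair-lift-< : ∀ y r R s S → Sorted R → r < s → r ≤ y → All (s ≤_) S →
  (∀ v → proj₂ (rowInsert y R) ≡ just v → s ≤ v) →
  insertPair y (lift R S) ≡ map₁ (uncurry lift) (insertPair y (R , S)) →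
  insertPair y (lift (r ∷ R) (s ∷ S)) ≡ map₁ (uncurry lift) (insertPair y (r ∷ R , s ∷ S))
insertPair-lift-< y r R s S sR r<s r≤y s≤S s≤bump ih
  rewrite <⇒<ᵇ≡true r<s | ≥⇒<ᵇ≡false r≤y
        | rowInsertMaybe-skip (proj₂ (rowInsert y (proj₁ (lift R S)))) s (proj₂ (lift R S))
            (rowInsert-lift₁-bumped-≥ y R S s sR s≤S s≤bump)
        | rowInsertMaybe-skip (proj₂ (rowInsert y R)) s S s≤bump
        | <⇒<ᵇ≡true r<s
  = cong (map₁ (map (r ∷_) (s ∷_))) ih

insertPair-lift-<-bumped< : ∀ y r R s S {v} → All (s ≤_) S → r < s → r ≤ y →
  proj₂ (rowInsert y R) ≡ just v → v < s →
  insertPair y (lift (r ∷ R) (s ∷ S)) ≡ map₁ (uncurry lift) (insertPair y (r ∷ R , s ∷ S))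
insertPair-lift-<-bumped< y r R s S {v} s≤S r<s r≤y eq v<s
  rewrite <⇒<ᵇ≡true r<s | ≥⇒<ᵇ≡false r≤y
        | proj₁ (rowInsert-lift₁ y R S eq (All.map (<-≤-trans v<s) s≤S))
        | eq | <⇒<ᵇ≡true v<s
        | <⇒<ᵇ≡true {r} {v} (≤-<-trans r≤y (rowInsert-<-bumped y R eq))
        | proj₂ (rowInsert-lift₁ y R S eq (All.map (<-≤-trans v<s) s≤S))
  = refl

-- The hypothesis on drop 1 S is what column insertion into the rows below R guarantees.
insertPair-lift : ∀ y R S → Sorted R → Sorted S → ColumnStrict R (drop 1 S) →
  insertPair y (lift R S) ≡ map₁ (uncurry lift) (insertPair y (R , S))
insertPair-lift y [] [] _ _ _ = refl
insertPair-lift y [] (s ∷ []) _ _ _ with y <ᵇ s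
... | true  = refl
... | false = refl
insertPair-lift y (r ∷ R) [] _ _ _ with y <ᵇ r in e
... | true rewrite e = refl
... | false with proj₂ (rowInsert y R) in e′
...   | nothing = refl
...   | just v
  rewrite <⇒<ᵇ≡true {r} {v} (≤-<-trans (<ᵇ≡false⇒≥ e) (rowInsert-<-bumped y R e′)) = refl
insertPair-lift y (r ∷ R) (s ∷ S) (r≤R ∷ sR) (s≤S ∷ sS) c with r <? s
... | no r≮s = insertPair-lift-≥ y r R s S r≤R (≮⇒≥ r≮s) c
... | yes r<s with y <? r
...   | yes y<r
  rewrite <⇒<ᵇ≡true r<s | <⇒<ᵇ≡true y<r | <⇒<ᵇ≡true r<s | <⇒<ᵇ≡true y<r = refl
...   | no y≮r with proj₂ (rowInsert y R) in eq
...     | nothing = insertPair-lift-< y r R s S sR r<s (≮⇒≥ y≮r) s≤S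
                      (λ v ev → case trans (sym eq) ev of λ ())
                      (insertPair-lift y R S sR sS (ColumnStrict-drop₁ r R S c))
...     | just v with v <? s
...       | yes v<s = insertPair-lift-<-bumped< y r R s S s≤S r<s (≮⇒≥ y≮r) eq v<s
...       | no v≮s  = insertPair-lift-< y r R s S sR r<s (≮⇒≥ y≮r) s≤S
                        (λ u eu → subst (s ≤_) (just-injective (trans (sym eq) eu)) (≮⇒≥ v≮s))
                        (insertPair-lift y R S sR sS (ColumnStrict-drop₁ r R S c))

-- Column insertion

placeOnTop : Row → Tableau → Tableau
placeOnTop R []      = R ∷ []
placeOnTop R (S ∷ U) = proj₁ (lift R S) ∷ proj₂ (lift R S) ∷ U

-- Column insertion of x, one row at a time: if x ≤ the first entry of the top row, x enters
-- column 1 there and pushes the whole row one column right; otherwise x is column-inserted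
-- into the rows below, and the entry it ejects into the second row is lifted back up.
columnInsert : ℕ → Tableau → Tableau
columnInsert x []            = (x ∷ []) ∷ []
columnInsert x ([] ∷ T)      = (x ∷ []) ∷ T
columnInsert x ((r ∷ R) ∷ T) with r <ᵇ x
... | true  = placeOnTop (r ∷ R) (columnInsert x T)
... | false = (x ∷ r ∷ R) ∷ T

columnInsert-front : ∀ x R U → All (x ≤_) R → columnInsert x (R ∷ U) ≡ (x ∷ R) ∷ U
columnInsert-front x []      U _       = refl
columnInsert-front x (r ∷ R) U (p ∷ _) rewrite ≥⇒<ᵇ≡false {r} {x} p = refl

columnInsert-below : ∀ x h H U → h < x →
  columnInsert x ((h ∷ H) ∷ U) ≡ placeOnTop (h ∷ H) (columnInsert x U)
columnInsert-below x h H U h<x rewrite <⇒<ᵇ≡true h<x = refl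

columnInsert-rowInsert-below : ∀ x y r R U → r < x →
  columnInsert x (proj₁ (rowInsert y (r ∷ R)) ∷ U)
    ≡ placeOnTop (proj₁ (rowInsert y (r ∷ R))) (columnInsert x U)
columnInsert-rowInsert-below x y r R U r<x with y <ᵇ r in e
... | true  = columnInsert-below x y R U (<-trans (<ᵇ≡true⇒< e) r<x)
... | false = columnInsert-below x r _ U r<x

columnInsert-∷ : ∀ x T → columnInsert x T ≡ firstRow (columnInsert x T) ∷ drop 1 (columnInsert x T)
columnInsert-∷ x []            = refl
columnInsert-∷ x ([] ∷ T)      = refl
columnInsert-∷ x ((r ∷ R) ∷ T) with r <ᵇ x
... | false = refl
... | true with columnInsert x T
...   | []    = refl
...   | _ ∷ _ = refl

firstRow-placeOnTop : ∀ R U → firstRow (placeOnTop R U) ≡ proj₁ (lift R (firstRow U))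
firstRow-placeOnTop R []      = refl
firstRow-placeOnTop R (S ∷ U) = refl

columnInsert-firstRow : ∀ x T R → Semistandard T → Sorted R → ColumnStrict R (firstRow T) →
  Sorted (firstRow (columnInsert x T)) × ColumnStrict R (drop 1 (firstRow (columnInsert x T)))
columnInsert-firstRow x []            R _                  _  _ = ([] ∷ []) , tt
columnInsert-firstRow x ([] ∷ T)      R (_ , []≢[] , _)    _  _ = ⊥-elim ([]≢[] refl)
columnInsert-firstRow x ((b ∷ B) ∷ T) R (sB@(b≤B ∷ _) , _ , cT , sT) sR c with b <? x
... | no b≮x rewrite ≥⇒<ᵇ≡false (≮⇒≥ b≮x) =
  (≮⇒≥ b≮x ∷ All.map (≤-trans (≮⇒≥ b≮x)) b≤B) ∷ sB , c
... | yes b<x rewrite <⇒<ᵇ≡true b<x | firstRow-placeOnTop (b ∷ B) (columnInsert x T) =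
  lift₁-sorted (b ∷ B) S sB sS , ColumnStrict-drop₁-lift₁ R b B S sR sB sS c
  where
  S  = firstRow (columnInsert x T)
  sS = proj₁ (columnInsert-firstRow x T (b ∷ B) sT sB cT)

stackPair : (Row × Row) × Maybe ℕ → Tableau → Tableau
stackPair ((R , S) , m) U = R ∷ S ∷ insertMaybe m U

insert-∷-∷ : ∀ y R S U → insert y (R ∷ S ∷ U) ≡ stackPair (insertPair y (R , S)) U
insert-∷-∷ y R S U rewrite insert-∷ y R (S ∷ U) | insertMaybe-∷ (proj₂ (rowInsert y R)) S U = refl

insert-columnInsert-front-< : ∀ x y r R T → Sorted (r ∷ R) → ColumnStrict (r ∷ R) (firstRow T) →
  Semistandard T → x ≤ r → y < x →
  insert y ((x ∷ r ∷ R) ∷ T) ≡ columnInsert x (insert y ((r ∷ R) ∷ T))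
insert-columnInsert-front-< x y r R [] (r≤R ∷ _) _ _ x≤r y<x
  rewrite <⇒<ᵇ≡true y<x | <⇒<ᵇ≡true {y} {r} (<-≤-trans y<x x≤r) | <⇒<ᵇ≡true y<x
        | ≥⇒<ᵇ≡false {r} {x} x≤r | <⇒<ᵇ≡true y<x | lift-≤-head r R [] r≤R = refl
insert-columnInsert-front-< x y r R ([] ∷ T) _ _ (_ , []≢[] , _) = ⊥-elim ([]≢[] refl)
insert-columnInsert-front-< x y r R ((t ∷ T₀) ∷ T) (r≤R ∷ _) (r<t , _) _ x≤r y<x
  rewrite <⇒<ᵇ≡true y<x | <⇒<ᵇ≡true {y} {r} (<-≤-trans y<x x≤r)
        | <⇒<ᵇ≡true {x} {t} (≤-<-trans x≤r r<t)
        | <⇒<ᵇ≡true y<x | <⇒<ᵇ≡true r<t | ≥⇒<ᵇ≡false {r} {x} x≤r | <⇒<ᵇ≡true y<x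
        | lift-≤-head r R T₀ r≤R = refl

insert-columnInsert-front-≥ : ∀ x y R T → All (x ≤_) R → x ≤ y →
  insert y ((x ∷ R) ∷ T) ≡ columnInsert x (insert y (R ∷ T))
insert-columnInsert-front-≥ x y R T x≤R x≤y = begin
  insert y ((x ∷ R) ∷ T)                                    ≡⟨ insert-∷ y (x ∷ R) T ⟩
  proj₁ (rowInsert y (x ∷ R)) ∷ insertMaybe (proj₂ (rowInsert y (x ∷ R))) T
    ≡⟨ cong (λ p → proj₁ p ∷ insertMaybe (proj₂ p) T) (rowInsert-skip y x R x≤y) ⟩
  (x ∷ R₁) ∷ insertMaybe m T                                ≡⟨ columnInsert-front x R₁ _ x≤R₁ ⟨
  columnInsert x (R₁ ∷ insertMaybe m T)                     ≡⟨ cong (columnInsert x) (insert-∷ y R T) ⟨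
  columnInsert x (insert y (R ∷ T))                         ∎
  where
  open ≡-Reasoning
  R₁ = proj₁ (rowInsert y R)
  m  = proj₂ (rowInsert y R)
  x≤R₁ = rowInsert-All y R x≤R x≤y

insert-columnInsert-below : ∀ x y r R T → Sorted (r ∷ R) → ColumnStrict (r ∷ R) (firstRow T) →
  Semistandard T → r < x → (∀ z → insert z (columnInsert x T) ≡ columnInsert x (insert z T)) →
  insert y (columnInsert x ((r ∷ R) ∷ T)) ≡ columnInsert x (insert y ((r ∷ R) ∷ T))
insert-columnInsert-below x y r R T sR c sT r<x ih = begin
  insert y (columnInsert x ((r ∷ R) ∷ T))
    ≡⟨ cong (insert y) (columnInsert-below x r R T r<x) ⟩
  insert y (placeOnTop (r ∷ R) (columnInsert x T))
    ≡⟨ cong (insert y ∘ placeOnTop (r ∷ R)) (columnInsert-∷ x T) ⟩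
  insert y (placeOnTop (r ∷ R) (S ∷ U))
    ≡⟨ insert-∷-∷ y (proj₁ (lift (r ∷ R) S)) (proj₂ (lift (r ∷ R) S)) U ⟩
  stackPair (insertPair y (lift (r ∷ R) S)) U
    ≡⟨ cong (λ p → stackPair p U) (insertPair-lift y (r ∷ R) S sR sS c′) ⟩
  placeOnTop R₁ (proj₁ (rowInsertMaybe m S) ∷ insertMaybe (proj₂ (rowInsertMaybe m S)) U)
    ≡⟨ cong (placeOnTop R₁) (insertMaybe-∷ m S U) ⟨
  placeOnTop R₁ (insertMaybe m (S ∷ U))
    ≡⟨ cong (placeOnTop R₁ ∘ insertMaybe m) (columnInsert-∷ x T) ⟨
  placeOnTop R₁ (insertMaybe m (columnInsert x T))
    ≡⟨ cong (placeOnTop R₁) (ihMaybe m) ⟨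
  placeOnTop R₁ (columnInsert x (insertMaybe m T))
    ≡⟨ columnInsert-rowInsert-below x y r R (insertMaybe m T) r<x ⟨
  columnInsert x (R₁ ∷ insertMaybe m T)
    ≡⟨ cong (columnInsert x) (insert-∷ y (r ∷ R) T) ⟨
  columnInsert x (insert y ((r ∷ R) ∷ T))
    ∎
  where
  open ≡-Reasoning
  S  = firstRow (columnInsert x T)
  U  = drop 1 (columnInsert x T)
  R₁ = proj₁ (rowInsert y (r ∷ R))
  m  = proj₂ (rowInsert y (r ∷ R))
  sS = proj₁ (columnInsert-firstRow x T (r ∷ R) sT sR c)
  c′ = proj₂ (columnInsert-firstRow x T (r ∷ R) sT sR c)
  ihMaybe : ∀ n → columnInsert x (insertMaybe n T) ≡ insertMaybe n (columnInsert x T)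
  ihMaybe nothing  = refl
  ihMaybe (just z) = sym (ih z)

insert-columnInsert : ∀ x y T → Semistandard T →
  insert y (columnInsert x T) ≡ columnInsert x (insert y T)
insert-columnInsert x y [] _ with y <? x
... | yes y<x rewrite <⇒<ᵇ≡true y<x | <⇒<ᵇ≡true y<x = refl
... | no y≮x  rewrite ≥⇒<ᵇ≡false (≮⇒≥ y≮x) = refl
insert-columnInsert x y ([] ∷ T) (_ , []≢[] , _) = ⊥-elim ([]≢[] refl)
insert-columnInsert x y ((r ∷ R) ∷ T) (sR@(r≤R ∷ _) , _ , c , sT) with r <? x
... | yes r<x = insert-columnInsert-below x y r R T sR c sT r<x (λ z → insert-columnInsert x z T sT)
... | no r≮x = trans (cong (insert y) (columnInsert-front x (r ∷ R) T x≤rR)) x-on-top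
  where
  x≤r = ≮⇒≥ r≮x
  x≤rR = x≤r ∷ All.map (≤-trans x≤r) r≤R
  x-on-top : insert y ((x ∷ r ∷ R) ∷ T) ≡ columnInsert x (insert y ((r ∷ R) ∷ T))
  x-on-top with y <? x
  ... | yes y<x = insert-columnInsert-front-< x y r R T sR c sT x≤r y<x
  ... | no y≮x  = insert-columnInsert-front-≥ x y (r ∷ R) T x≤rR (≮⇒≥ y≮x)

insertWord : Tableau → Word → Tableau
insertWord = foldl (λ T x → insert x T)

insertWord-columnInsert : ∀ x w T → Semistandard T →
  insertWord (columnInsert x T) w ≡ columnInsert x (insertWord T w)
insertWord-columnInsert x []      T sT = refl
insertWord-columnInsert x (c ∷ w) T sT rewrite insert-columnInsert x c T sT =
  insertWord-columnInsert x w (insert c T) (insert-semistandard c T sT)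

P-∷ : ∀ a w → P (a ∷ w) ≡ columnInsert a (P w)
P-∷ a w = insertWord-columnInsert a w [] tt

P-∷ʳ : ∀ w a → P (w ++ [ a ]) ≡ insert a (P w)
P-∷ʳ w a = foldl-++ (λ T x → insert x T) [] w [ a ]

-- Multiplicities and partial sums

mult-++ : ∀ b xs ys → mult b (xs ++ ys) ≡ mult b xs + mult b ys
mult-++ b xs ys =
  trans (cong length (filter-++ (λ y → y ≟ b) xs ys)) (length-++ (filter (λ y → y ≟ b) xs))

mult-↭ : ∀ b {xs ys} → xs ↭ ys → mult b xs ≡ mult b ys
mult-↭ b p = ↭-length (filter-↭ (λ y → y ≟ b) p)

mult-++-↭ : ∀ b xs ys zs ws → xs ++ ys ↭ zs ++ ws → mult b xs + mult b ys ≡ mult b zs + mult b ws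
mult-++-↭ b xs ys zs ws p = trans (sym (mult-++ b xs ys)) (trans (mult-↭ b p) (mult-++ b zs ws))

mult-⊆ : ∀ b {xs ys} → xs ⊆ ys → mult b xs ≤ mult b ys
mult-⊆ b p =
  Sublist.length-mono-≤ (Sublist.filter⁺ (λ y → y ≟ b) (λ y → y ≟ b) (λ { refl q → q }) p)

mult-≢ : ∀ {b x} → x ≢ b → mult b [ x ] ≡ 0
mult-≢ {b} x≢b = cong length (filter-reject (λ y → y ≟ b) x≢b)

rowInsert-↭ : ∀ y R → proj₁ (rowInsert y R) ++ fromMaybe (proj₂ (rowInsert y R)) ↭ y ∷ R
rowInsert-↭ y []      = ↭-refl
rowInsert-↭ y (r ∷ R) with y <ᵇ r
... | true  = ↭-prep y (↭-sym (∷↭∷ʳ r R))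
... | false = ↭-trans (↭-prep r (rowInsert-↭ y R)) (↭-swap r y ↭-refl)

lift-↭ : ∀ R S → proj₁ (lift R S) ++ proj₂ (lift R S) ↭ R ++ S
lift-↭ R       []      = ↭-refl
lift-↭ []      (s ∷ S) = ↭-refl
lift-↭ (r ∷ R) (s ∷ S) with r <ᵇ s
... | true  = ↭-prep r (↭-trans (shift s (proj₁ (lift R S)) (proj₂ (lift R S)))
                       (↭-trans (↭-prep s (lift-↭ R S)) (↭-sym (shift s R S))))
... | false = ↭-sym (shift s (r ∷ R) S)

⊆-lift₁ : ∀ R S → R ⊆ proj₁ (lift R S)
⊆-lift₁ R       []      = ⊆-refl
⊆-lift₁ []      (s ∷ S) = s ∷ʳ []
⊆-lift₁ (r ∷ R) (s ∷ S) with r <ᵇ s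
... | true  = refl ∷ ⊆-lift₁ R S
... | false = s ∷ʳ ⊆-refl

insertMaybe-partialSum : ∀ b m T i →
  partialSum i (α b (insertMaybe m T)) ≤ mult b (fromMaybe m) + partialSum i (α b T)
insertMaybe-partialSum b nothing  T       i             = ≤-refl
insertMaybe-partialSum b (just y) []      zero          = z≤n
insertMaybe-partialSum b (just y) []      (suc zero)    = ≤-refl
insertMaybe-partialSum b (just y) []      (suc (suc i)) = ≤-refl
insertMaybe-partialSum b (just y) (R ∷ T) zero          = z≤n
insertMaybe-partialSum b (just y) (R ∷ T) (suc i) rewrite insert-∷ y R T = begin
  mult b R′ + partialSum i (α b (insertMaybe m T))          ≤⟨ +-monoʳ-≤ (mult b R′) ih ⟩
  mult b R′ + (mult b (fromMaybe m) + partialSum i (α b T)) ≡⟨ +-assoc (mult b R′) _ _ ⟨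
  mult b R′ + mult b (fromMaybe m) + partialSum i (α b T)   ≡⟨ cong (_+ partialSum i (α b T)) rowInsert-mult ⟩
  mult b [ y ] + mult b R + partialSum i (α b T)            ≡⟨ +-assoc (mult b [ y ]) _ _ ⟩
  mult b [ y ] + (mult b R + partialSum i (α b T))          ∎
  where
  open ≤-Reasoning
  R′ = proj₁ (rowInsert y R)
  m  = proj₂ (rowInsert y R)
  ih = insertMaybe-partialSum b m T i
  rowInsert-mult = mult-++-↭ b R′ (fromMaybe m) [ y ] R (rowInsert-↭ y R)

placeOnTop-partialSum : ∀ b R T U → (∀ j → partialSum j (α b T) ≤ partialSum j (α b U)) →
  ∀ i → partialSum i (α b (R ∷ T)) ≤ partialSum i (α b (placeOnTop R U))
placeOnTop-partialSum b R T U       T≤U zero          = z≤n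
placeOnTop-partialSum b R T []      T≤U (suc j)       = +-monoʳ-≤ (mult b R) (T≤U j)
placeOnTop-partialSum b R T (S ∷ U) T≤U (suc zero)    = +-monoˡ-≤ 0 (mult-⊆ b (⊆-lift₁ R S))
placeOnTop-partialSum b R T (S ∷ U) T≤U (suc (suc j)) = begin
  mult b R + partialSum (suc j) (α b T)          ≤⟨ +-monoʳ-≤ (mult b R) (T≤U (suc j)) ⟩
  mult b R + (mult b S + partialSum j (α b U))   ≡⟨ +-assoc (mult b R) _ _ ⟨
  mult b R + mult b S + partialSum j (α b U)     ≡⟨ cong (_+ partialSum j (α b U)) lift-mult ⟨
  mult b L₁ + mult b L₂ + partialSum j (α b U)   ≡⟨ +-assoc (mult b L₁) _ _ ⟩
  mult b L₁ + (mult b L₂ + partialSum j (α b U)) ∎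
  where
  open ≤-Reasoning
  L₁ = proj₁ (lift R S)
  L₂ = proj₂ (lift R S)
  lift-mult = mult-++-↭ b L₁ L₂ R S (lift-↭ R S)

columnInsert-partialSum : ∀ b x T i → partialSum i (α b T) ≤ partialSum i (α b (columnInsert x T))
columnInsert-partialSum b x []            zero    = z≤n
columnInsert-partialSum b x []            (suc i) = z≤n
columnInsert-partialSum b x ([] ∷ T)      zero    = z≤n
columnInsert-partialSum b x ([] ∷ T)      (suc i) = m≤n+m _ (mult b [ x ])
columnInsert-partialSum b x ((r ∷ R) ∷ T) i with r <ᵇ x
columnInsert-partialSum b x ((r ∷ R) ∷ T) zero    | false = z≤n
columnInsert-partialSum b x ((r ∷ R) ∷ T) (suc i) | false = +-monoˡ-≤ _ (mult-⊆ b (x ∷ʳ ⊆-refl))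
... | true = placeOnTop-partialSum b (r ∷ R) T (columnInsert x T) (columnInsert-partialSum b x T) i

insert-⪯ : ∀ {a b} → a ≢ b → ∀ T → α b (insert a T) ⪯ α b T
insert-⪯ {a} {b} a≢b T i _ =
  subst (λ k → partialSum i (α b (insert a T)) ≤ k + partialSum i (α b T)) (mult-≢ a≢b)
    (insertMaybe-partialSum b (just a) T i)

⪯-columnInsert : ∀ b x T → α b T ⪯ α b (columnInsert x T)
⪯-columnInsert b x T i _ = columnInsert-partialSum b x T i

lemma2p1 : (a b : ℕ) → 0 < a → 0 < b → a ≢ b →
    (w : List ℕ) → All (λ x → 0 < x) w →
    (α b (P (w ++ (a ∷ []))) ⪯ α b (P w)) × (α b (P w) ⪯ α b (P (a ∷ w)))
lemma2p1 a b _ _ a≢b w _ rewrite P-∷ʳ w a | P-∷ a w =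
  insert-⪯ a≢b (P w) , ⪯-columnInsert b a (P w)
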